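{- Let $N$ be a neuron, $id,len\in\mathbb{N}$, $\mathit{inp}$ a list of input functions and $i$ an input function. Suppose $\mathit{One\_input}(N,id,len)$, $N$ is initial, and $\tau_N\le w_N(id)$. Then (1) $CurPot_N(i::\mathit{inp},len)=w_N(id)$ if $i(id)=1$, and $CurPot_N(i::\mathit{inp},len)=0$ otherwise (equality of rationals); (2) $Output_N(i::\mathit{inp},len)=i(id)::Output_N(\mathit{inp},len)$.
   Context: Booleans are identified with $0$ (false) and $1$ (true). A neuron $N$ consists of an identifier $id_N\in\mathbb{N}$, a weight function $w_N:\mathbb{N}\to\mathbb{Q}$ with $-1\le w_N(x)\le 1$ for all $x$ and $w_N(id_N)=0$, a leak factor $lk_N\in\mathbb{Q}$ with $0\le lk_N\le 1$, a threshold $\tau_N\in\mathbb{Q}$ with $\tau_N>0$, an output list $Output(N)$ of booleans (most recent first) and a current potential $CurPot(N)\in\mathbb{Q}$, subject to: $(\tau_N\le CurPot(N))$ equals the head of $Output(N)$ (the head of an empty list being $0$). An input function is a map $i:\mathbb{N}\to\{0,1\}$; $potential(w,i,len)=\sum_{0\le k<len,\ i(k)=1} w(k)$. The one-step update of $N$ with input function $i$ in an environment of $len$ neurons keeps $id,w,lk,\tau$, sets the new potential $p=potential(w_N,i,len)$ if $\tau_N\le CurPot(N)$ and $p=potential(w_N,i,len)+lk_N\cdot CurPot(N)$ otherwise, and sets the new output list to $(\tau_N\le p)::Output(N)$. For a list of input functions (most recent first), $AfterNsteps(N,[\,],len)=N$ and $AfterNsteps(N,i::\mathit{inp},len)$ is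 the one-step update of $AfterNsteps(N,\mathit{inp},len)$ with $i$; $Output_N(\mathit{inp},len)$ and $CurPot_N(\mathit{inp},len)$ denote its output list and current potential. $N$ is initial if $Output(N)=[0]$ and $CurPot(N)=0$. $\mathit{One\_input}(N,id,len)$ means $id<len$ and $w_N(id')=0$ for all $id'\neq id$ with $id'<len$. -}

module Defs where

open import Data.Nat as ℕ using (ℕ; zero; suc)
open import Data.Rational using (ℚ; 0ℚ; 1ℚ; -_; _+_; _*_; _≤_; _<_)
open import Data.Rational.Properties using (_≤?_)
open import Data.Bool using (Bool; true; false; if_then_else_)
open import Data.List using (List; []; _∷_)
open import Relation.Nullary.Decidable using (⌊_⌋)
open import Relation.Binary.PropositionalEquality using (_≡_; _≢_)
open import Data.Product using (_×_)

headB : List Bool → Bool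
headB []      = false
headB (b ∷ _) = b

_≤ᵇ_ : ℚ → ℚ → Bool
x ≤ᵇ y = ⌊ x ≤? y ⌋

record Neuron : Set where
  field
    Id     : ℕ
    W      : ℕ → ℚ
    Lk     : ℚ
    Tau    : ℚ
    Output : List Bool
    CurPot : ℚ
    W-bounds  : ∀ x → (- 1ℚ ≤ W x) × (W x ≤ 1ℚ)
    W-self    : W Id ≡ 0ℚ
    Lk-bounds : (0ℚ ≤ Lk) × (Lk ≤ 1ℚ)
    Tau-pos   : 0ℚ < Tau
    Inv       : (Tau ≤ᵇ CurPot) ≡ headB Output
open Neuron public

Input : Set
Input = ℕ → Bool

potential : (ℕ → ℚ) → Input → ℕ → ℚ
potential w i zero    = 0ℚ
potential w i (suc k) = (if i k then w k else 0ℚ) + potential w i k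

-- one-step update of N with input i in an environment of len neurons
NextNeuron : Input → ℕ → Neuron → Neuron
NextNeuron i len N = record
  { Id = Id N ; W = W N ; Lk = Lk N ; Tau = Tau N
  ; Output = (Tau N ≤ᵇ p) ∷ Output N
  ; CurPot = p
  ; W-bounds = W-bounds N ; W-self = W-self N
  ; Lk-bounds = Lk-bounds N ; Tau-pos = Tau-pos N
  ; Inv = Relation.Binary.PropositionalEquality.refl }
  where
  p : ℚ
  p = if Tau N ≤ᵇ CurPot N
        then potential (W N) i len
        else potential (W N) i len + Lk N * CurPot N

-- inputs listed most recent first
AfterNsteps : Neuron → List Input → ℕ → Neuron
AfterNsteps N []        len = N
AfterNsteps N (i ∷ inp) len = NextNeuron i len (AfterNsteps N inp len)

OutputN : Neuron → List Input → ℕ → List Bool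
OutputN N inp len = Output (AfterNsteps N inp len)

CurPotN : Neuron → List Input → ℕ → ℚ
CurPotN N inp len = CurPot (AfterNsteps N inp len)

Initial : Neuron → Set
Initial N = (Output N ≡ false ∷ []) × (CurPot N ≡ 0ℚ)

One-input : Neuron → ℕ → ℕ → Set
One-input N id len = (id ℕ.< len) × (∀ id′ → id′ ≢ id → id′ ℕ.< len → W N id′ ≡ 0ℚ)

{-# OPTIONS --safe #-}
-- A neuron whose only incoming weight w(id) satisfies 0 < τ ≤ w(id) acts as a relay.
-- After every step its potential is either 0 (it did not fire) or w(id) (it fired), and
-- in both cases nothing is carried over by the leak: a zero potential leaks nothing, and
-- firing resets the potential.  So each new potential is just the weighted input
-- i(id)·w(id), which reaches the threshold exactly when i(id) = 1.
module Submission where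

open import Defs
open import Data.Nat as ℕ using (ℕ; zero; suc; _≟_; s≤s⁻¹)
open import Data.Nat.Properties using (≤-refl; <⇒≢; m<n⇒m<1+n; ≤∧≢⇒<)
open import Data.Rational using (ℚ; 0ℚ; _≤_; _<_; _+_)
open import Data.Rational.Properties
  using (<-irrefl; <-≤-trans; +-identityˡ; +-identityʳ; *-zeroʳ; _≤?_)
open import Data.Bool using (true; false; if_then_else_)
open import Data.List using (List; _∷_; [])
open import Data.Product using (_×_; _,_; proj₁)
open import Data.Sum using (_⊎_; inj₁; inj₂)
open import Function using (_∘_)
open import Relation.Nullary using (¬_; yes; no)
open import Relation.Nullary.Decidable using (isYes≗does; dec-true; dec-false)
open import Relation.Binary.PropositionalEquality
  using (_≡_; _≢_; refl; sym; trans; cong; cong₂; subst)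

<⇒≱ : ∀ {p q : ℚ} → p < q → ¬ q ≤ p
<⇒≱ p<q q≤p = <-irrefl refl (<-≤-trans p<q q≤p)

≤⇒≤ᵇ≡true : ∀ {p q} → p ≤ q → (p ≤ᵇ q) ≡ true
≤⇒≤ᵇ≡true {p} {q} p≤q = trans (isYes≗does (p ≤? q)) (dec-true (p ≤? q) p≤q)

≰⇒≤ᵇ≡false : ∀ {p q} → ¬ p ≤ q → (p ≤ᵇ q) ≡ false
≰⇒≤ᵇ≡false {p} {q} p≰q = trans (isYes≗does (p ≤? q)) (dec-false (p ≤? q) p≰q)

contribution : (ℕ → ℚ) → Input → ℕ → ℚ
contribution w i k = if i k then w k else 0ℚ

contribution≡0ℚ : ∀ w i k → w k ≡ 0ℚ → contribution w i k ≡ 0ℚ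
contribution≡0ℚ w i k wk≡0 with i k
... | true  = wk≡0
... | false = refl

potential≡0ℚ : ∀ w i k → (∀ j → j ℕ.< k → w j ≡ 0ℚ) → potential w i k ≡ 0ℚ
potential≡0ℚ w i zero    _   = refl
potential≡0ℚ w i (suc k) w≡0 = trans
  (cong₂ _+_ (contribution≡0ℚ w i k (w≡0 k ≤-refl))
             (potential≡0ℚ w i k (λ j → w≡0 j ∘ m<n⇒m<1+n)))
  (+-identityˡ 0ℚ)

potential-single-weight : ∀ w i {id} k → id ℕ.< k →
  (∀ j → j ≢ id → j ℕ.< k → w j ≡ 0ℚ) → potential w i k ≡ contribution w i id
potential-single-weight w i {id} (suc k) id<1+k w≡0 with k ≟ id
... | yes refl = trans
  (cong (contribution w i k +_)
        (potential≡0ℚ w i k (λ j j<k → w≡0 j (<⇒≢ j<k) (m<n⇒m<1+n j<k))))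
  (+-identityʳ _)
... | no k≢id = trans
  (cong₂ _+_ (contribution≡0ℚ w i k (w≡0 k k≢id ≤-refl))
             (potential-single-weight w i k (≤∧≢⇒< (s≤s⁻¹ id<1+k) (k≢id ∘ sym))
                                         (λ j j≢id → w≡0 j j≢id ∘ m<n⇒m<1+n)))
  (+-identityˡ _)

≤ᵇ-spike : ∀ {τ x} b → 0ℚ < τ → τ ≤ x → (τ ≤ᵇ (if b then x else 0ℚ)) ≡ b
≤ᵇ-spike true  _   τ≤x = ≤⇒≤ᵇ≡true τ≤x
≤ᵇ-spike false 0<τ _   = ≰⇒≤ᵇ≡false (<⇒≱ 0<τ)

-- Potentials from which the leak carries nothing into the next step (firing resets).
Settled : ℚ → ℚ → Set
Settled τ p = p ≡ 0ℚ ⊎ τ ≤ p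

spike-settled : ∀ {τ x} b → τ ≤ x → Settled τ (if b then x else 0ℚ)
spike-settled true  τ≤x = inj₂ τ≤x
spike-settled false _   = inj₁ refl

CurPot-NextNeuron-settled : ∀ i len M → Settled (Tau M) (CurPot M) →
  CurPot (NextNeuron i len M) ≡ potential (W M) i len
CurPot-NextNeuron-settled i len M (inj₁ p≡0)
  rewrite p≡0 | ≰⇒≤ᵇ≡false (<⇒≱ (Tau-pos M)) =
  trans (cong (potential (W M) i len +_) (*-zeroʳ (Lk M))) (+-identityʳ _)
CurPot-NextNeuron-settled i len M (inj₂ τ≤p)
  rewrite ≤⇒≤ᵇ≡true τ≤p = refl

Relay : ℕ → ℕ → Neuron → Set
Relay id len M = One-input M id len × Tau M ≤ W M id × Settled (Tau M) (CurPot M)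

NextNeuron-relay : ∀ {id len} i M → Relay id len M →
  (CurPot (NextNeuron i len M) ≡ contribution (W M) i id)
  × (Output (NextNeuron i len M) ≡ i id ∷ Output M)
NextNeuron-relay {id} {len} i M ((id<len , w≡0) , τ≤w , settled) =
  curPot , cong (_∷ Output M) (trans (cong (Tau M ≤ᵇ_) curPot) (≤ᵇ-spike (i id) (Tau-pos M) τ≤w))
  where
  curPot : CurPot (NextNeuron i len M) ≡ contribution (W M) i id
  curPot = trans (CurPot-NextNeuron-settled i len M settled)
                 (potential-single-weight (W M) i len id<len w≡0)

NextNeuron-preserves-Relay : ∀ {id len} i M → Relay id len M → Relay id len (NextNeuron i len M)
NextNeuron-preserves-Relay {id} i M relay@(oneInput , τ≤w , _) =
  oneInput , τ≤w ,
  subst (Settled (Tau M)) (sym (proj₁ (NextNeuron-relay i M relay))) (spike-settled (i id) τ≤w)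

AfterNsteps-invariant : ∀ {len} (P : Neuron → Set) → (∀ i M → P M → P (NextNeuron i len M)) →
  ∀ {N} inp → P N → P (AfterNsteps N inp len)
AfterNsteps-invariant P step []        pN = pN
AfterNsteps-invariant P step (i ∷ inp) pN = step i _ (AfterNsteps-invariant P step inp pN)

AfterNsteps-Relay : ∀ {N id len} inp → One-input N id len → Initial N → Tau N ≤ W N id →
  Relay id len (AfterNsteps N inp len)
AfterNsteps-Relay inp oneInput (_ , curPot≡0) τ≤w =
  AfterNsteps-invariant (Relay _ _) NextNeuron-preserves-Relay inp (oneInput , τ≤w , inj₁ curPot≡0)

W-AfterNsteps : ∀ N inp len → W (AfterNsteps N inp len) ≡ W N
W-AfterNsteps N []        len = refl
W-AfterNsteps N (_ ∷ inp) len = W-AfterNsteps N inp len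

lemma4p7 : (N : Neuron) (id len : ℕ) (inp : List Input) (i : Input) →
    One-input N id len → Initial N → Tau N ≤ W N id →
    (CurPotN N (i ∷ inp) len ≡ (if i id then W N id else 0ℚ))
    × (OutputN N (i ∷ inp) len ≡ i id ∷ OutputN N inp len)
lemma4p7 N id len inp i oneInput initial τ≤w =
  let curPot , output = NextNeuron-relay i (AfterNsteps N inp len)
                          (AfterNsteps-Relay inp oneInput initial τ≤w)
  in trans curPot (cong (λ w → contribution w i id) (W-AfterNsteps N inp len)) , output
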